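{- Let $\circledast,\odot$ be proper multiplications on $\mathbb{Z}^d$ which are aligned. Then $d^*_\circledast=d^*_\odot$, i.e. $d^*_\circledast(A)=d^*_\odot(A)$ for every $A\subseteq\mathbb{Z}^d_{\neq 0}$.
   Context: A proper multiplication on $\mathbb{Z}^d$ is a binary operation $\circledast:\mathbb{Z}^d\times\mathbb{Z}^d\to\mathbb{Z}^d$ making $(\mathbb{Z}^d,+)$ an associative (not necessarily commutative or unital) ring without zero divisors; $\mathbb{Z}^d_{\neq0}=\mathbb{Z}^d\setminus\{0\}$. Two proper multiplications $\circledast,\odot$ are aligned if there exist $v,w\in\mathbb{Z}^d_{\neq 0}$ with $x\circledast v\circledast y=x\odot w\odot y$ for all $x,y\in\mathbb{Z}^d$. For $A\subseteq\mathbb{Z}^d_{\neq0}$, the density $d^*_\circledast(A)=\sup\{\alpha\ge 0:\ \text{for every finite } F\subseteq\mathbb{Z}^d_{\neq0}\text{ there is } s\in\mathbb{Z}^d_{\neq0}\text{ with } |(F\circledast s)\cap A|\ge\alpha|F|\}$, where $F\circledast s=\{f\circledast s: f\in F\}$. -}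

module Defs where

open import Level using (0ℓ)
open import Data.Nat as ℕ using (ℕ)
open import Data.Integer as ℤ using (ℤ; +_)
open import Data.Rational as ℚ using (ℚ; _/_)
open import Data.Vec using (Vec; replicate; zipWith)
open import Data.List using (List; length)
open import Data.List.Relation.Unary.All using (All)
open import Data.List.Relation.Unary.Unique.Propositional using (Unique)
open import Data.List.Membership.Propositional using (_∈_)
open import Data.Product using (Σ; ∃; ∃-syntax; _×_; _,_)
open import Data.Sum using (_⊎_)
open import Relation.Binary.PropositionalEquality using (_≡_; _≢_)
open import Relation.Unary using (Pred)

ℤ^ : ℕ → Set
ℤ^ d = Vec ℤ d

𝟘 : ∀ {d} → ℤ^ d
𝟘 {d} = replicate d (+ 0)

_⊕_ : ∀ {d} → ℤ^ d → ℤ^ d → ℤ^ d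
_⊕_ = zipWith ℤ._+_

record ProperMultiplication (d : ℕ) : Set where
  field
    _⊛_        : ℤ^ d → ℤ^ d → ℤ^ d
    assoc      : ∀ x y z → (x ⊛ y) ⊛ z ≡ x ⊛ (y ⊛ z)
    distribˡ   : ∀ x y z → x ⊛ (y ⊕ z) ≡ (x ⊛ y) ⊕ (x ⊛ z)
    distribʳ   : ∀ x y z → (y ⊕ z) ⊛ x ≡ (y ⊛ x) ⊕ (z ⊛ x)
    noZeroDiv  : ∀ x y → x ⊛ y ≡ 𝟘 → x ≡ 𝟘 ⊎ y ≡ 𝟘

open ProperMultiplication public using (_⊛_)

Aligned : ∀ {d} → ProperMultiplication d → ProperMultiplication d → Set
Aligned {d} M N =
  Σ (ℤ^ d) λ v → Σ (ℤ^ d) λ w → v ≢ 𝟘 × w ≢ 𝟘 ×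
    (∀ x y → (M ⊛ ((M ⊛ x) v)) y ≡ (N ⊛ ((N ⊛ x) w)) y)

-- A finite subset F of ℤ^d_{≠0}: a duplicate-free list of nonzero vectors;
-- |F| = its length.
FinNonzero : ℕ → Set
FinNonzero d = Σ (List (ℤ^ d)) λ F → Unique F × All (λ x → x ≢ 𝟘) F

_∈[_⊛_]_ : ∀ {d} → ℤ^ d → ProperMultiplication d → List (ℤ^ d) → ℤ^ d → Set
x ∈[ M ⊛ F ] s = ∃[ f ] (f ∈ F × x ≡ (M ⊛ f) s)

ℕ→ℚ : ℕ → ℚ
ℕ→ℚ n = + n / 1

-- |(F ⊛ s) ∩ A| ≥ α |F|, expressed (without requiring A decidable) as:
-- there are at least α|F| distinct elements in (F ⊛ s) ∩ A.
LargeIntersection : ∀ {d} → ProperMultiplication d → Pred (ℤ^ d) 0ℓ →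
                    ℚ → List (ℤ^ d) → ℤ^ d → Set
LargeIntersection M A α F s =
  Σ (List _) λ L → Unique L × All A L × All (λ x → x ∈[ M ⊛ F ] s) L ×
    (α ℚ.* ℕ→ℚ (length F) ℚ.≤ ℕ→ℚ (length L))

Admissible : ∀ {d} → ProperMultiplication d → Pred (ℤ^ d) 0ℓ → ℚ → Set
Admissible {d} M A α =
  ℚ.0ℚ ℚ.≤ α ×
  ((F : FinNonzero d) → let (Fl , _) = F in
     Σ (ℤ^ d) λ s → s ≢ 𝟘 × LargeIntersection M A α Fl s)

-- d*_M(A) ≤ d*_N(A), where d*_M(A) = sup { α ≥ 0 : Admissible M A α }.
-- Since the admissible sets are down-closed in [0,∞), this is equivalent to:
-- for all rationals 0 ≤ r < q, if q is admissible for M then r is for N.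
Density≤ : ∀ {d} → ProperMultiplication d → ProperMultiplication d →
           Pred (ℤ^ d) 0ℓ → Set
Density≤ M N A = ∀ (q r : ℚ) → ℚ.0ℚ ℚ.≤ r → r ℚ.< q →
                 Admissible M A q → Admissible N A r

DensityEq : ∀ {d} → ProperMultiplication d → ProperMultiplication d →
            Pred (ℤ^ d) 0ℓ → Set
DensityEq M N A = Density≤ M N A × Density≤ N M A

{-# OPTIONS --safe #-}
module Submission where

-- If x ⊛ v ⊛ y = x ⊙ w ⊙ y, then for every finite F ⊆ ℤᵈ∖{0} the set F ⊛ v is again
-- finite, avoids 0 and has |F| elements (right multiplication by v ≠ 0 is injective in
-- a ring without zero divisors), and (F ⊛ v) ⊛ s = F ⊙ (w ⊙ s).  So a shift s that makes
-- (F ⊛ v) ⊛ s meet A in a proportion α yields the shift w ⊙ s ≠ 0 doing the same for F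
-- and ⊙: both multiplications admit the same densities α, hence have the same supremum.

open import Defs
open import Level using (0ℓ)
open import Data.Nat using (ℕ)
import Data.Integer as ℤ
import Data.Integer.Properties as ℤ
import Data.Rational as ℚ
import Data.Rational.Properties as ℚ
open import Data.Vec using (map)
open import Data.Vec.Properties
  using (zipWith-assoc; zipWith-identityˡ; zipWith-identityʳ; zipWith-inverseˡ; zipWith-inverseʳ)
open import Data.List as List using (length)
open import Data.List.Properties using (length-map)
import Data.List.Relation.Unary.All as All
open import Data.List.Relation.Unary.All.Properties using (gmap⁺)
import Data.List.Relation.Unary.Unique.Propositional.Properties as Unique
open import Data.List.Membership.Propositional.Properties using (∈-map⁻)
open import Data.Product using (Σ; _×_; _,_; proj₁)
open import Data.Sum using ([_,_]′; fromInj₁)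
open import Function using (_∘_)
open import Relation.Nullary using (contradiction)
open import Relation.Binary.PropositionalEquality
open import Relation.Unary using (Pred)
open import Algebra.Bundles using (Group)
open import Algebra.Structures using (IsGroup)
open import Algebra.Definitions using (AlmostRightCancellative)
import Algebra.Properties.Group as GroupProperties

⊕-isGroup : ∀ {d} → IsGroup _≡_ (_⊕_ {d}) 𝟘 (map (λ z → ℤ.- z))
⊕-isGroup = record
  { isMonoid = record
    { isSemigroup = record
      { isMagma = record { isEquivalence = isEquivalence ; ∙-cong = cong₂ _⊕_ }
      ; assoc   = zipWith-assoc ℤ.+-assoc
      }
    ; identity = zipWith-identityˡ ℤ.+-identityˡ , zipWith-identityʳ ℤ.+-identityʳ
    }
  ; inverse = zipWith-inverseˡ ℤ.+-inverseˡ , zipWith-inverseʳ ℤ.+-inverseʳ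
  ; ⁻¹-cong = cong (map (λ z → ℤ.- z))
  }

⊕-group : ℕ → Group 0ℓ 0ℓ
⊕-group d = record { isGroup = ⊕-isGroup {d} }

module _ {d : ℕ} (M : ProperMultiplication d) where
  open ProperMultiplication M renaming (_⊛_ to _*_)
  open Group (⊕-group d) using (_//_; identityˡ)
  open GroupProperties (⊕-group d) using (∙-cancelʳ; //-rightDividesˡ; x∙y⁻¹≈ε⇒x≈y)

  ⊛-nonZero : ∀ {x y} → x ≢ 𝟘 → y ≢ 𝟘 → x * y ≢ 𝟘
  ⊛-nonZero x≢0 y≢0 = [ x≢0 , y≢0 ]′ ∘ noZeroDiv _ _

  ⊛-almostCancelʳ : AlmostRightCancellative _≡_ 𝟘 _*_
  ⊛-almostCancelʳ v f g v≢0 fv≡gv =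
    x∙y⁻¹≈ε⇒x≈y f g (fromInj₁ (λ v≡0 → contradiction v≡0 v≢0)
                       (noZeroDiv (f // g) v (∙-cancelʳ (g * v) _ _ f//g*v+gv≡0+gv)))
    where
    open ≡-Reasoning
    f//g*v+gv≡0+gv : ((f // g) * v) ⊕ (g * v) ≡ 𝟘 ⊕ (g * v)
    f//g*v+gv≡0+gv = begin
      ((f // g) * v) ⊕ (g * v) ≡⟨ distribʳ v (f // g) g ⟨
      ((f // g) ⊕ g) * v       ≡⟨ cong (_* v) (//-rightDividesˡ g f) ⟩
      f * v                    ≡⟨ fv≡gv ⟩
      g * v                    ≡⟨ identityˡ (g * v) ⟨
      𝟘 ⊕ (g * v)              ∎

  finNonzero-⊛ʳ : FinNonzero d → ∀ {v} → v ≢ 𝟘 → FinNonzero d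
  finNonzero-⊛ʳ (F , F-unique , F-nonZero) {v} v≢0 =
    List.map (_* v) F ,
    Unique.map⁺ (⊛-almostCancelʳ v _ _ v≢0) F-unique ,
    gmap⁺ (λ f≢0 → ⊛-nonZero f≢0 v≢0) F-nonZero

module _ {d : ℕ} {A : Pred (ℤ^ d) 0ℓ} where

  largeIntersection-≤ : (M : ProperMultiplication d) → ∀ {q r F s} → r ℚ.≤ q →
    LargeIntersection M A q F s → LargeIntersection M A r F s
  largeIntersection-≤ _ {F = F} r≤q (L , L-unique , L⊆A , L⊆F⊛s , large) =
    L , L-unique , L⊆A , L⊆F⊛s ,
    ℚ.≤-trans (ℚ.*-monoʳ-≤-nonNeg (ℕ→ℚ (length F)) {{ℚ.normalize-nonNeg (length F) 1}} r≤q)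
              large

  largeIntersection-transport : (M N : ProperMultiplication d) → ∀ {α F G s t} →
    length F ≡ length G → (∀ {x} → x ∈[ M ⊛ F ] s → x ∈[ N ⊛ G ] t) →
    LargeIntersection M A α F s → LargeIntersection N A α G t
  largeIntersection-transport _ _ {α} |F|≡|G| F⊛s⊆G⊛t (L , L-unique , L⊆A , L⊆F⊛s , large) =
    L , L-unique , L⊆A , All.map F⊛s⊆G⊛t L⊆F⊛s ,
    subst (λ n → α ℚ.* ℕ→ℚ n ℚ.≤ ℕ→ℚ (length L)) |F|≡|G| large

module _ {d : ℕ} (M N : ProperMultiplication d) where
  open ProperMultiplication M using () renaming (_⊛_ to _*_)
  open ProperMultiplication N using (assoc) renaming (_⊛_ to _⊙_)

  aligned-sym : Aligned M N → Aligned N M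
  aligned-sym (v , w , v≢0 , w≢0 , x*v*y≡x⊙w⊙y) =
    w , v , w≢0 , v≢0 , λ x y → sym (x*v*y≡x⊙w⊙y x y)

  ∈-⊛-aligned : ∀ {v w} → (∀ x y → (x * v) * y ≡ (x ⊙ w) ⊙ y) →
    ∀ {F s x} → x ∈[ M ⊛ List.map (_* v) F ] s → x ∈[ N ⊛ F ] (w ⊙ s)
  ∈-⊛-aligned x*v*y≡x⊙w⊙y (_ , fv∈F*v , x≡fv*s) with ∈-map⁻ _ fv∈F*v
  ... | f , f∈F , refl = f , f∈F , trans x≡fv*s (trans (x*v*y≡x⊙w⊙y f _) (assoc f _ _))

  admissible-aligned : ∀ {A α} → Aligned M N → Admissible M A α → Admissible N A α
  admissible-aligned {A} {α} (v , w , v≢0 , w≢0 , x*v*y≡x⊙w⊙y) (0≤α , large) = 0≤α , largeN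
    where
    largeN : (F : FinNonzero d) → Σ (ℤ^ d) λ t → t ≢ 𝟘 × LargeIntersection N A α (proj₁ F) t
    largeN F with large (finNonzero-⊛ʳ M F v≢0)
    ... | s , s≢0 , I =
      w ⊙ s , ⊛-nonZero N w≢0 s≢0 ,
      largeIntersection-transport M N {α} (length-map _ (proj₁ F)) (∈-⊛-aligned x*v*y≡x⊙w⊙y) I

admissible-downClosed : ∀ {d} (M : ProperMultiplication d) {A q r} →
  ℚ.0ℚ ℚ.≤ r → r ℚ.≤ q → Admissible M A q → Admissible M A r
admissible-downClosed M 0≤r r≤q (_ , large) =
  0≤r , λ F → let s , s≢0 , I = large F in s , s≢0 , largeIntersection-≤ M r≤q I

density≤-aligned : ∀ {d} (M N : ProperMultiplication d) → Aligned M N →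
  (A : Pred (ℤ^ d) 0ℓ) → Density≤ M N A
density≤-aligned M N aligned A q r 0≤r r<q =
  admissible-downClosed N 0≤r (ℚ.<⇒≤ r<q) ∘ admissible-aligned M N aligned

theorem5p1 : (d : ℕ) (M N : ProperMultiplication d) → Aligned M N →
    (A : Pred (ℤ^ d) 0ℓ) → (∀ x → A x → x ≢ 𝟘) → DensityEq M N A
theorem5p1 d M N aligned A _ =
  density≤-aligned M N aligned A , density≤-aligned N M (aligned-sym M N aligned) A
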